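{- For any time warp $f$, any $n\in\omega\setminus\{0\}$ and any $m\in\omega$: (i) $f'(n)=m$ iff $f(m)<n\le f(m+1)$; (ii) $f'(\omega)=m$ iff $f(m)<\omega=f(m+1)$; (iii) $f'(n)=\omega$ iff $f(\omega)<n$; (iv) $f'(\omega)=\omega$ iff $f(\omega)<\omega$ or $\mathrm{last}(f)=\omega$.
   Context: Let $\omega^+=\omega\cup\{\omega\}$ with its natural order. A time warp is a join-preserving map $f\colon\omega^+\to\omega^+$ (equivalently, order-preserving with $f(0)=0$ and $f(\omega)=\sup_{n\in\omega}f(n)$). Let $p$ be the predecessor time warp ($p(0)=0$, $p(\omega)=\omega$, $p(m)=m-1$ for $0<m<\omega$). For a time warp $f$, $f'$ is the largest time warp $g$ with $f\circ g\le p$ pointwise (equivalently, the largest $g$ with $g\circ f\le p$). For a time warp $f$, $\mathrm{last}(f)=\min\{m\in\omega^+\mid f(m)=f(\omega)\}$. -}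

module Defs where

open import Data.Nat using (ℕ; zero; suc) renaming (_≤_ to _≤ℕ_; _<_ to _<ℕ_)
open import Data.Product using (Σ; _×_)
open import Relation.Binary.PropositionalEquality using (_≡_)

data ω⁺ : Set where
  fin : ℕ → ω⁺
  ω   : ω⁺

data _≤⁺_ : ω⁺ → ω⁺ → Set where
  fin≤fin : ∀ {m n} → m ≤ℕ n → fin m ≤⁺ fin n
  x≤ω     : ∀ {x} → x ≤⁺ ω

data _<⁺_ : ω⁺ → ω⁺ → Set where
  fin<fin : ∀ {m n} → m <ℕ n → fin m <⁺ fin n
  fin<ω   : ∀ {m} → fin m <⁺ ω

IsSup : (ℕ → ω⁺) → ω⁺ → Set
IsSup s x = (∀ n → s n ≤⁺ x) × (∀ y → (∀ n → s n ≤⁺ y) → x ≤⁺ y)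

IsTimeWarp : (ω⁺ → ω⁺) → Set
IsTimeWarp f =
  (∀ x y → x ≤⁺ y → f x ≤⁺ f y) ×
  (f (fin 0) ≡ fin 0) ×
  IsSup (λ n → f (fin n)) (f ω)

pred⁺ : ω⁺ → ω⁺
pred⁺ (fin zero)    = fin zero
pred⁺ (fin (suc m)) = fin m
pred⁺ ω             = ω

_≤ᶠ_ : (ω⁺ → ω⁺) → (ω⁺ → ω⁺) → Set
f ≤ᶠ g = ∀ x → f x ≤⁺ g x

_∘⁺_ : (ω⁺ → ω⁺) → (ω⁺ → ω⁺) → (ω⁺ → ω⁺)
(f ∘⁺ g) x = f (g x)

IsPrime : (ω⁺ → ω⁺) → (ω⁺ → ω⁺) → Set
IsPrime f g =
  IsTimeWarp g ×
  ((f ∘⁺ g) ≤ᶠ pred⁺) ×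
  (∀ h → IsTimeWarp h → (f ∘⁺ h) ≤ᶠ pred⁺ → h ≤ᶠ g)

IsLast : (ω⁺ → ω⁺) → ω⁺ → Set
IsLast f l = (f l ≡ f ω) × (∀ m → f m ≡ f ω → l ≤⁺ m)

-- At successor arguments f′ is a right adjoint of f: y ≤ f′(k+1) iff
-- f(y) ≤ k.  One direction is f ∘ f′ ≤ p; for the other, the join of f′
-- with the step warp jumping from 0 to y at k+1 is again a time warp g with
-- f ∘ g ≤ p, so maximality puts it below f′.  Parts (i) and (iii) are read
-- off from this, and since f′(ω) is the supremum of the f′(k+1), m ≤ f′(ω)
-- iff f(m) is finite, which gives parts (ii) and (iv).
module Submission where

open import Defs
open import Data.Nat using (ℕ; zero; suc; NonZero; _⊔_; z≤n; s≤s)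
import Data.Nat.Properties as ℕ
open import Data.Product using (_×_; _,_; proj₁; proj₂)
open import Data.Product.Function.NonDependent.Propositional using (_×-⇔_)
open import Data.Sum using (_⊎_; inj₁; inj₂)
open import Data.Empty using (⊥-elim)
open import Function using (_∘_)
open import Function.Bundles using (_⇔_; mk⇔; Equivalence)
import Function.Properties.Equivalence as Eq
open import Function.Related.Propositional using (module EquationalReasoning)
open import Function.Related.TypeIsomorphisms using (¬-cong-⇔)
open import Relation.Nullary using (¬_; Dec; yes; no)
open import Relation.Binary.PropositionalEquality using (_≡_; refl; sym; trans; cong; subst)

∀-cong-⇔ : {A : Set} {P Q : A → Set} → (∀ a → P a ⇔ Q a) → (∀ a → P a) ⇔ (∀ a → Q a)
∀-cong-⇔ P⇔Q = mk⇔ (λ p a → Equivalence.to (P⇔Q a) (p a))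
                   (λ q a → Equivalence.from (P⇔Q a) (q a))

≤⁺-refl : ∀ {x} → x ≤⁺ x
≤⁺-refl {fin n} = fin≤fin ℕ.≤-refl
≤⁺-refl {ω}     = x≤ω

≤⁺-reflexive : ∀ {x y} → x ≡ y → x ≤⁺ y
≤⁺-reflexive refl = ≤⁺-refl

≤⁺-trans : ∀ {x y z} → x ≤⁺ y → y ≤⁺ z → x ≤⁺ z
≤⁺-trans (fin≤fin p) (fin≤fin q) = fin≤fin (ℕ.≤-trans p q)
≤⁺-trans _           x≤ω         = x≤ω

≤⁺-antisym : ∀ {x y} → x ≤⁺ y → y ≤⁺ x → x ≡ y
≤⁺-antisym (fin≤fin p) (fin≤fin q) = cong fin (ℕ.≤-antisym p q)
≤⁺-antisym x≤ω         x≤ω         = refl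

z≤⁺ : ∀ {x} → fin 0 ≤⁺ x
z≤⁺ {fin n} = fin≤fin z≤n
z≤⁺ {ω}     = x≤ω

_≤⁺?_ : ∀ x y → Dec (x ≤⁺ y)
fin m ≤⁺? fin n with m ℕ.≤? n
... | yes m≤n = yes (fin≤fin m≤n)
... | no  m≰n = no λ { (fin≤fin m≤n) → m≰n m≤n }
fin m ≤⁺? ω     = yes x≤ω
ω     ≤⁺? fin n = no λ ()
ω     ≤⁺? ω     = yes x≤ω

<⁺-suc⇔≤⁺ : ∀ {x k} → (x <⁺ fin (suc k)) ⇔ (x ≤⁺ fin k)
<⁺-suc⇔≤⁺ = mk⇔ (λ { (fin<fin (s≤s m≤k)) → fin≤fin m≤k })
                (λ { (fin≤fin m≤k) → fin<fin (s≤s m≤k) })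

≰⁺⇔suc≤⁺ : ∀ {x k} → (¬ x ≤⁺ fin k) ⇔ (fin (suc k) ≤⁺ x)
≰⁺⇔suc≤⁺ {x} {k} = mk⇔ (to x) from
  where
  to : ∀ x → ¬ x ≤⁺ fin k → fin (suc k) ≤⁺ x
  to ω       _   = x≤ω
  to (fin m) m≰k with m ℕ.≤? k
  ... | yes m≤k = ⊥-elim (m≰k (fin≤fin m≤k))
  ... | no  m≰k = fin≤fin (ℕ.≰⇒> m≰k)
  from : fin (suc k) ≤⁺ x → ¬ x ≤⁺ fin k
  from (fin≤fin k<m) (fin≤fin m≤k) = ℕ.<-irrefl refl (ℕ.<-≤-trans k<m m≤k)

suc≰⁺⇔≤⁺ : ∀ {x k} → (¬ fin (suc k) ≤⁺ x) ⇔ (x ≤⁺ fin k)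
suc≰⁺⇔≤⁺ {x} {k} = mk⇔ (to x) from
  where
  to : ∀ x → ¬ fin (suc k) ≤⁺ x → x ≤⁺ fin k
  to ω       k≮ω = ⊥-elim (k≮ω x≤ω)
  to (fin m) k≮m = fin≤fin (ℕ.≮⇒≥ (k≮m ∘ fin≤fin))
  from : x ≤⁺ fin k → ¬ fin (suc k) ≤⁺ x
  from (fin≤fin m≤k) (fin≤fin k<m) = ℕ.<-irrefl refl (ℕ.<-≤-trans k<m m≤k)

≮⁺ω⇔≡ω : ∀ {x} → (¬ x <⁺ ω) ⇔ (x ≡ ω)
≮⁺ω⇔≡ω {fin n} = mk⇔ (λ x≮ω → ⊥-elim (x≮ω fin<ω)) (λ ())
≮⁺ω⇔≡ω {ω}     = mk⇔ (λ _ → refl) (λ _ ())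

≡fin⇔fin≤⁺×suc≰⁺ : ∀ {x m} → (x ≡ fin m) ⇔ (fin m ≤⁺ x × ¬ fin (suc m) ≤⁺ x)
≡fin⇔fin≤⁺×suc≰⁺ {x} {m} = mk⇔ to from
  where
  to : x ≡ fin m → fin m ≤⁺ x × ¬ fin (suc m) ≤⁺ x
  to refl = ≤⁺-refl , λ { (fin≤fin m<m) → ℕ.<-irrefl refl m<m }
  from : fin m ≤⁺ x × ¬ fin (suc m) ≤⁺ x → x ≡ fin m
  from (m≤x , x≯m) = ≤⁺-antisym (Equivalence.to suc≰⁺⇔≤⁺ x≯m) m≤x

≡ω⇔ω≤⁺ : ∀ {x} → (x ≡ ω) ⇔ (ω ≤⁺ x)
≡ω⇔ω≤⁺ = mk⇔ (λ { refl → x≤ω }) (≤⁺-antisym x≤ω)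

≡ω⇔fin≤⁺ : ∀ {x} → (x ≡ ω) ⇔ (∀ m → fin m ≤⁺ x)
≡ω⇔fin≤⁺ {x} = mk⇔ (λ { refl m → x≤ω }) (from x)
  where
  from : ∀ x → (∀ m → fin m ≤⁺ x) → x ≡ ω
  from ω       _   = refl
  from (fin n) m≤n with m≤n (suc n)
  ... | fin≤fin n<n = ⊥-elim (ℕ.<-irrefl refl n<n)

infixl 30 _⊔⁺_

_⊔⁺_ : ω⁺ → ω⁺ → ω⁺
fin m ⊔⁺ fin n = fin (m ⊔ n)
fin m ⊔⁺ ω     = ω
ω     ⊔⁺ _     = ω

x≤⁺x⊔⁺y : ∀ x y → x ≤⁺ x ⊔⁺ y
x≤⁺x⊔⁺y (fin m) (fin n) = fin≤fin (ℕ.m≤m⊔n m n)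
x≤⁺x⊔⁺y (fin m) ω       = x≤ω
x≤⁺x⊔⁺y ω       _       = x≤ω

y≤⁺x⊔⁺y : ∀ x y → y ≤⁺ x ⊔⁺ y
y≤⁺x⊔⁺y (fin m) (fin n) = fin≤fin (ℕ.m≤n⊔m m n)
y≤⁺x⊔⁺y (fin m) ω       = x≤ω
y≤⁺x⊔⁺y ω       _       = x≤ω

⊔⁺-lub : ∀ {x y z} → x ≤⁺ z → y ≤⁺ z → x ⊔⁺ y ≤⁺ z
⊔⁺-lub _           x≤ω         = x≤ω
⊔⁺-lub (fin≤fin p) (fin≤fin q) = fin≤fin (ℕ.⊔-lub p q)

⊔⁺-mono-≤⁺ : ∀ {x y u v} → x ≤⁺ u → y ≤⁺ v → x ⊔⁺ y ≤⁺ u ⊔⁺ v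
⊔⁺-mono-≤⁺ {u = u} {v} x≤u y≤v =
  ⊔⁺-lub (≤⁺-trans x≤u (x≤⁺x⊔⁺y u v)) (≤⁺-trans y≤v (y≤⁺x⊔⁺y u v))

⊔⁺-sel : ∀ x y → (x ⊔⁺ y ≡ x) ⊎ (x ⊔⁺ y ≡ y)
⊔⁺-sel (fin m) (fin n) with ℕ.⊔-sel m n
... | inj₁ m⊔n≡m = inj₁ (cong fin m⊔n≡m)
... | inj₂ m⊔n≡n = inj₂ (cong fin m⊔n≡n)
⊔⁺-sel (fin m) ω = inj₂ refl
⊔⁺-sel ω       _ = inj₁ refl

_⊔ᶠ_ : (ω⁺ → ω⁺) → (ω⁺ → ω⁺) → (ω⁺ → ω⁺)
(g ⊔ᶠ h) x = g x ⊔⁺ h x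

⊔ᶠ-isTimeWarp : ∀ {g h} → IsTimeWarp g → IsTimeWarp h → IsTimeWarp (g ⊔ᶠ h)
⊔ᶠ-isTimeWarp {g} {h} (g-mono , g0≡0 , g-sup) (h-mono , h0≡0 , h-sup) =
  mono , zero-preserved , (λ n → mono (fin n) ω x≤ω) , least
  where
  mono : ∀ x y → x ≤⁺ y → (g ⊔ᶠ h) x ≤⁺ (g ⊔ᶠ h) y
  mono x y x≤y = ⊔⁺-mono-≤⁺ (g-mono x y x≤y) (h-mono x y x≤y)
  zero-preserved : (g ⊔ᶠ h) (fin 0) ≡ fin 0
  zero-preserved rewrite g0≡0 | h0≡0 = refl
  least : ∀ z → (∀ n → (g ⊔ᶠ h) (fin n) ≤⁺ z) → (g ⊔ᶠ h) ω ≤⁺ z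
  least z bound =
    ⊔⁺-lub (proj₂ g-sup z λ n → ≤⁺-trans (x≤⁺x⊔⁺y _ _) (bound n))
           (proj₂ h-sup z λ n → ≤⁺-trans (y≤⁺x⊔⁺y _ _) (bound n))

∘⊔ᶠ-≤ᶠ : ∀ {f g h q} → (f ∘⁺ g) ≤ᶠ q → (f ∘⁺ h) ≤ᶠ q → (f ∘⁺ (g ⊔ᶠ h)) ≤ᶠ q
∘⊔ᶠ-≤ᶠ {f} {g} {h} {q} fg≤q fh≤q x with ⊔⁺-sel (g x) (h x)
... | inj₁ ≡gx = subst (λ v → f v ≤⁺ q x) (sym ≡gx) (fg≤q x)
... | inj₂ ≡hx = subst (λ v → f v ≤⁺ q x) (sym ≡hx) (fh≤q x)

step : ℕ → ω⁺ → ω⁺ → ω⁺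
step k y x with fin (suc k) ≤⁺? x
... | yes _ = y
... | no  _ = fin 0

step-at : ∀ k y → step k y (fin (suc k)) ≡ y
step-at k y with fin (suc k) ≤⁺? fin (suc k)
... | yes _ = refl
... | no  k≰k = ⊥-elim (k≰k ≤⁺-refl)

step-isTimeWarp : ∀ k y → IsTimeWarp (step k y)
step-isTimeWarp k y = mono , refl , (λ n → mono (fin n) ω x≤ω) , least
  where
  mono : ∀ x z → x ≤⁺ z → step k y x ≤⁺ step k y z
  mono x z x≤z with fin (suc k) ≤⁺? x | fin (suc k) ≤⁺? z
  ... | yes _   | yes _   = ≤⁺-refl
  ... | yes k≤x | no  k≰z = ⊥-elim (k≰z (≤⁺-trans k≤x x≤z))
  ... | no  _   | yes _   = z≤⁺
  ... | no  _   | no  _   = ≤⁺-refl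
  least : ∀ z → (∀ n → step k y (fin n) ≤⁺ z) → step k y ω ≤⁺ z
  least z bound = subst (_≤⁺ z) (step-at k y) (bound (suc k))

∘step-≤ᶠpred : ∀ {f k y} → f (fin 0) ≡ fin 0 → f y ≤⁺ fin k → (f ∘⁺ step k y) ≤ᶠ pred⁺
∘step-≤ᶠpred {k = k} f0≡0 fy≤k x with fin (suc k) ≤⁺? x
∘step-≤ᶠpred f0≡0 fy≤k (fin (suc n)) | yes (fin≤fin (s≤s k≤n)) = ≤⁺-trans fy≤k (fin≤fin k≤n)
∘step-≤ᶠpred f0≡0 fy≤k ω             | yes _ = x≤ω
∘step-≤ᶠpred f0≡0 fy≤k (fin zero)    | yes (fin≤fin ())
... | no _ = subst (_≤⁺ pred⁺ x) (sym f0≡0) z≤⁺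

≤⁺-<⁺ω : ∀ {x y} → x ≤⁺ y → y <⁺ ω → x <⁺ ω
≤⁺-<⁺ω (fin≤fin _) fin<ω = fin<ω

finite-on-fin⇔ : ∀ {f} → (∀ x y → x ≤⁺ y → f x ≤⁺ f y) →
  (∀ m → f (fin m) <⁺ ω) ⇔ ((f ω <⁺ ω) ⊎ IsLast f ω)
finite-on-fin⇔ {f} f-mono = mk⇔ to from
  where
  to : (∀ m → f (fin m) <⁺ ω) → (f ω <⁺ ω) ⊎ IsLast f ω
  to finite with f ω
  ... | fin _ = inj₁ fin<ω
  ... | ω     = inj₂ (refl , attained-only-at-ω)
    where
    attained-only-at-ω : ∀ x → f x ≡ ω → ω ≤⁺ x
    attained-only-at-ω ω       _    = x≤ω
    attained-only-at-ω (fin m) fm≡ω = ⊥-elim (Equivalence.from ≮⁺ω⇔≡ω fm≡ω (finite m))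
  from : (f ω <⁺ ω) ⊎ IsLast f ω → ∀ m → f (fin m) <⁺ ω
  from (inj₁ fω<ω) m = ≤⁺-<⁺ω (f-mono (fin m) ω x≤ω) fω<ω
  from (inj₂ (_ , least)) m with f (fin m) in fm≡ω
  ... | fin _ = fin<ω
  ... | ω     = ⊥-elim (ω≰⁺fin (least (fin m) (trans fm≡ω (sym fω≡ω))))
    where
    fω≡ω : f ω ≡ ω
    fω≡ω = ≤⁺-antisym x≤ω (subst (_≤⁺ f ω) fm≡ω (f-mono (fin m) ω x≤ω))
    ω≰⁺fin : ¬ ω ≤⁺ fin m
    ω≰⁺fin ()

module _ {f f′ : ω⁺ → ω⁺} (f-warp : IsTimeWarp f) (f′-prime : IsPrime f f′) where

  private
    f-mono : ∀ x y → x ≤⁺ y → f x ≤⁺ f y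
    f-mono = proj₁ f-warp
    f0≡0 : f (fin 0) ≡ fin 0
    f0≡0 = proj₁ (proj₂ f-warp)
    f′-warp : IsTimeWarp f′
    f′-warp = proj₁ f′-prime
    f′-sup : IsSup (λ n → f′ (fin n)) (f′ ω)
    f′-sup = proj₂ (proj₂ f′-warp)
    ff′≤p : (f ∘⁺ f′) ≤ᶠ pred⁺
    ff′≤p = proj₁ (proj₂ f′-prime)
    f′-greatest : ∀ h → IsTimeWarp h → (f ∘⁺ h) ≤ᶠ pred⁺ → h ≤ᶠ f′
    f′-greatest = proj₂ (proj₂ f′-prime)

  ≤f′suc⇔ : ∀ {y k} → (y ≤⁺ f′ (fin (suc k))) ⇔ (f y ≤⁺ fin k)
  ≤f′suc⇔ {y} {k} = mk⇔ to from
    where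
    to : y ≤⁺ f′ (fin (suc k)) → f y ≤⁺ fin k
    to y≤ = ≤⁺-trans (f-mono _ _ y≤) (ff′≤p (fin (suc k)))
    from : f y ≤⁺ fin k → y ≤⁺ f′ (fin (suc k))
    from fy≤k = ≤⁺-trans y≤joint (joint≤f′ (fin (suc k)))
      where
      joint : ω⁺ → ω⁺
      joint = f′ ⊔ᶠ step k y
      y≤joint : y ≤⁺ joint (fin (suc k))
      y≤joint = subst (_≤⁺ joint (fin (suc k))) (step-at k y) (y≤⁺x⊔⁺y _ _)
      joint≤f′ : joint ≤ᶠ f′
      joint≤f′ = f′-greatest joint (⊔ᶠ-isTimeWarp f′-warp (step-isTimeWarp k y))
                                 (∘⊔ᶠ-≤ᶠ {f} ff′≤p (∘step-≤ᶠpred {f} f0≡0 fy≤k))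

  ≤f′fin⇒f<ω : ∀ {y n} → y ≤⁺ f′ (fin n) → f y <⁺ ω
  ≤f′fin⇒f<ω {n = n} y≤ = ≤⁺-<⁺ω (≤⁺-trans (f-mono _ _ y≤) (ff′≤p (fin n))) (pred-fin<ω n)
    where
    pred-fin<ω : ∀ n → pred⁺ (fin n) <⁺ ω
    pred-fin<ω zero    = fin<ω
    pred-fin<ω (suc _) = fin<ω

  fin≤f′ω⇔ : ∀ {m} → (fin m ≤⁺ f′ ω) ⇔ (f (fin m) <⁺ ω)
  fin≤f′ω⇔ {m} = mk⇔ (to m) from
    where
    to : ∀ m → fin m ≤⁺ f′ ω → f (fin m) <⁺ ω
    to zero    _        = subst (_<⁺ ω) (sym f0≡0) fin<ω
    to (suc l) sl≤f′ω with f (fin (suc l)) in fsl≡ω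
    ... | fin _ = fin<ω
    ... | ω     = ⊥-elim (Equivalence.from suc≰⁺⇔≤⁺ f′ω≤l sl≤f′ω)
      where
      f′ω≤l : f′ ω ≤⁺ fin l
      f′ω≤l = proj₂ f′-sup (fin l) λ n → Equivalence.to suc≰⁺⇔≤⁺ λ sl≤f′n →
        Equivalence.from ≮⁺ω⇔≡ω fsl≡ω (≤f′fin⇒f<ω sl≤f′n)
    from : f (fin m) <⁺ ω → fin m ≤⁺ f′ ω
    from fm<ω with f (fin m) in fm≡K
    ... | fin K = ≤⁺-trans (Equivalence.from ≤f′suc⇔ (≤⁺-reflexive fm≡K)) (proj₁ f′-sup (suc K))

  open EquationalReasoning

  f′suc≡fin⇔ : ∀ {k m} → (f′ (fin (suc k)) ≡ fin m) ⇔
    ((f (fin m) <⁺ fin (suc k)) × (fin (suc k) ≤⁺ f (fin (suc m))))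
  f′suc≡fin⇔ {k} {m} = begin
    f′ (fin (suc k)) ≡ fin m
      ∼⟨ ≡fin⇔fin≤⁺×suc≰⁺ ⟩
    (fin m ≤⁺ f′ (fin (suc k)) × ¬ fin (suc m) ≤⁺ f′ (fin (suc k)))
      ∼⟨ ≤f′suc⇔ ×-⇔ ¬-cong-⇔ ≤f′suc⇔ ⟩
    (f (fin m) ≤⁺ fin k × ¬ f (fin (suc m)) ≤⁺ fin k)
      ∼⟨ Eq.sym <⁺-suc⇔≤⁺ ×-⇔ ≰⁺⇔suc≤⁺ ⟩
    (f (fin m) <⁺ fin (suc k) × fin (suc k) ≤⁺ f (fin (suc m))) ∎

  f′ω≡fin⇔ : ∀ {m} → (f′ ω ≡ fin m) ⇔ ((f (fin m) <⁺ ω) × (f (fin (suc m)) ≡ ω))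
  f′ω≡fin⇔ {m} = begin
    f′ ω ≡ fin m
      ∼⟨ ≡fin⇔fin≤⁺×suc≰⁺ ⟩
    (fin m ≤⁺ f′ ω × ¬ fin (suc m) ≤⁺ f′ ω)
      ∼⟨ fin≤f′ω⇔ ×-⇔ ¬-cong-⇔ fin≤f′ω⇔ ⟩
    (f (fin m) <⁺ ω × ¬ f (fin (suc m)) <⁺ ω)
      ∼⟨ Eq.refl ×-⇔ ≮⁺ω⇔≡ω ⟩
    (f (fin m) <⁺ ω × f (fin (suc m)) ≡ ω) ∎

  f′suc≡ω⇔ : ∀ {k} → (f′ (fin (suc k)) ≡ ω) ⇔ (f ω <⁺ fin (suc k))
  f′suc≡ω⇔ {k} = begin
    f′ (fin (suc k)) ≡ ω      ∼⟨ ≡ω⇔ω≤⁺ ⟩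
    ω ≤⁺ f′ (fin (suc k))     ∼⟨ ≤f′suc⇔ ⟩
    f ω ≤⁺ fin k              ∼⟨ Eq.sym <⁺-suc⇔≤⁺ ⟩
    f ω <⁺ fin (suc k)        ∎

  f′ω≡ω⇔ : (f′ ω ≡ ω) ⇔ ((f ω <⁺ ω) ⊎ IsLast f ω)
  f′ω≡ω⇔ = begin
    f′ ω ≡ ω                        ∼⟨ ≡ω⇔fin≤⁺ ⟩
    (∀ m → fin m ≤⁺ f′ ω)           ∼⟨ ∀-cong-⇔ (λ _ → fin≤f′ω⇔) ⟩
    (∀ m → f (fin m) <⁺ ω)          ∼⟨ finite-on-fin⇔ f-mono ⟩
    ((f ω <⁺ ω) ⊎ IsLast f ω)       ∎

proposition2p7 : (f f′ : ω⁺ → ω⁺) → IsTimeWarp f → IsPrime f f′ →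
    (n : ℕ) → .{{NonZero n}} → (m : ℕ) →
      ((f′ (fin n) ≡ fin m) ⇔ ((f (fin m) <⁺ fin n) × (fin n ≤⁺ f (fin (suc m))))) ×
      ((f′ ω ≡ fin m) ⇔ ((f (fin m) <⁺ ω) × (f (fin (suc m)) ≡ ω))) ×
      ((f′ (fin n) ≡ ω) ⇔ (f ω <⁺ fin n)) ×
      ((f′ ω ≡ ω) ⇔ ((f ω <⁺ ω) ⊎ IsLast f ω))
proposition2p7 f f′ f-warp f′-prime (suc k) m =
  f′suc≡fin⇔ f-warp f′-prime , f′ω≡fin⇔ f-warp f′-prime ,
  f′suc≡ω⇔ f-warp f′-prime , f′ω≡ω⇔ f-warp f′-prime
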